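{- Let $\phi:W_f\to D^Sw_0$ be the bijection $v\mapsto w$ with window $w_i=n\,\mathrm{cl}(v)_i+v_i$. For $v,v'\in W_f$, one has $\phi(v')=\pi\,\phi(v)$ if and only if $v'$ is a corotation of $v$, i.e. $v_n\neq1$ and $v'=v_n\,v_1\,v_2\cdots v_{n-1}$.
   Context: Fix $n\ge2$. $W_e$: bijections $w:\mathbb Z\to\mathbb Z$ with $w(i+n)=w(i)+n$; $s_i$ swaps $i+kn,i+1+kn$; $\pi:k\mapsto k+1$; $W_e=\langle\pi\rangle\ltimes\langle s_0,\dots,s_{n-1}\rangle$, with length $\ell(\pi^kv)=\ell(v)$; $W_f=\langle s_1,\dots,s_{n-1}\rangle\cong\mathcal S_n$, longest element $w_0$. Translations $y_1=\pi s_{n-1}\cdots s_1$, $y_i=s_{i-1}\cdots s_1y_1s_1\cdots s_{i-1}$, $y^\beta=\prod y_i^{\beta_i}$. The word of $w$ is $w_i=n+1-w^{ -1}(i)$, identified with the window $w_1\cdots w_n$; $\pi w$ has window $(w_n+n,w_1,\dots,w_{n-1})$; $v\in W_f$ is identified with its window, a permutation of $[n]$. Cocharge labeling $\mathrm{cl}(v)$: entry $1$ of $v$ gets label $0$; if $i$ has label $k$, $i+1$ gets label $k$ if it is right of $i$ in $v$, else $k+1$; $\mathrm{cl}(v)_j$ = label of $v_j$. $D=\{\mathrm{cl}(v)\}$, $D^Sw_0=\{z_\beta w_0:\beta\in D\}$ with $z_\beta$ the minimal-length element of $y^\beta W_f$; $\phi$ is a bijection onto $D^Sw_0$. -}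

module Defs where

open import Data.Nat using (ℕ; zero; suc; _+_; _*_; _<?_)
open import Data.Fin using (Fin; toℕ; fromℕ<)
open import Data.Fin.Permutation using (Permutation′; _⟨$⟩ʳ_; _⟨$⟩ˡ_)
open import Data.Integer using (ℤ; +_)
import Data.Integer as ℤ
open import Data.Vec using (Vec; _∷_; tabulate; last; init)
open import Data.Bool using (if_then_else_)
open import Relation.Nullary using (yes; no; does)

-- Elements v of W_f ≅ S_n are permutations of Fin n; the window entry
-- v_j (j = 1..n) is  1 + toℕ (v ⟨$⟩ʳ (j-1)), a value in [n].

window : ∀ {n} → Permutation′ n → Vec (Fin n) n
window v = tabulate (λ j → v ⟨$⟩ʳ j)

-- 0-based position in the window of the value k+1 (junk 0 if k ≥ n).
posN : ∀ {n} → Permutation′ n → ℕ → ℕ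
posN {n} v k with k <? n
... | yes p = toℕ (v ⟨$⟩ˡ fromℕ< p)
... | no _  = 0

labelN : ∀ {n} → Permutation′ n → ℕ → ℕ
labelN v zero = 0
labelN v (suc k) =
  labelN v k + (if does (posN v k <? posN v (suc k)) then 0 else 1)

cl : ∀ {n} → Permutation′ n → Fin n → ℕ
cl v j = labelN v (toℕ (v ⟨$⟩ʳ j))

φ : ∀ {n} → Permutation′ n → Vec ℤ n
φ {n} v = tabulate (λ j → + (n * cl v j + suc (toℕ (v ⟨$⟩ʳ j))))

πW : ∀ {m} → Vec ℤ (suc m) → Vec ℤ (suc m)
πW {m} w = (last w ℤ.+ + suc m) ∷ init w

corot : ∀ {A : Set} {m} → Vec A (suc m) → Vec A (suc m)
corot w = last w ∷ init w

-- Shifting the last entry v_n = a of v to the front moves every position of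
-- the window by one, cyclically. Comparing positions of consecutive values,
-- the only steps of the cocharge labelling whose outcome changes are a-1 → a
-- (which becomes a descent) and a → a+1 (which stops being one), so the label
-- of a goes up by one and all other labels stay put. Hence
-- n·cl(v′)_j + v′_j is exactly the window of π φ(v). Conversely, a window
-- entry n·c + r with 1 ≤ r ≤ n determines c and r, so φ(v′) = π φ(v) forces
-- v′ to be the corotation of v, and a = 1 is excluded because the value 1 of
-- v′ would then carry label 1 instead of 0.
module Submission where

open import Defs
open import Data.Bool using (if_then_else_)
open import Data.Empty using (⊥-elim)
open import Data.Fin using (Fin; zero; suc; fromℕ; fromℕ<; toℕ; inject₁)
open import Data.Fin.Permutation
  using (Permutation′; _⟨$⟩ʳ_; _⟨$⟩ˡ_; inverseˡ; inverseʳ)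
import Data.Fin.Properties as Fin
import Data.Integer as ℤ
import Data.Integer.Properties as ℤₚ
open import Data.Nat using (ℕ; zero; suc; _+_; _*_; _<_; _≤_; _<?_; _≟_; NonZero; s≤s; s<s)
open import Data.Nat.DivMod using (_%_; [m+kn]%n≡m%n; m<n⇒m%n≡m)
open import Data.Nat.Properties
open import Data.Product using (_×_; _,_; proj₁; proj₂)
open import Data.Vec using (_∷_; tabulate; lookup; last; init)
open import Data.Vec.Properties using (lookup∘tabulate; tabulate-cong; ∷-injective)
open import Function using (_∘_)
open import Function.Bundles using (_⇔_; mk⇔; Equivalence)
open import Relation.Nullary using (does; yes; no)
open import Relation.Nullary.Decidable using (dec-true; dec-false)
open import Relation.Binary.PropositionalEquality
open ≡-Reasoning
open Equivalence using (to; from)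

descent : ℕ → ℕ → ℕ
descent x y = if does (x <? y) then 0 else 1

descent-< : ∀ {x y} → x < y → descent x y ≡ 0
descent-< {x} {y} x<y rewrite dec-true (x <? y) x<y = refl

descent-≥ : ∀ {x y} → y ≤ x → descent x y ≡ 1
descent-≥ {x} {y} y≤x rewrite dec-false (x <? y) (≤⇒≯ y≤x) = refl

descent-suc : ∀ x y → descent (suc x) (suc y) ≡ descent x y
descent-suc x y with x <? y
... | yes x<y = trans (descent-< (s<s x<y)) (sym (descent-< x<y))
... | no x≮y  = trans (descent-≥ (s≤s (≮⇒≥ x≮y))) (sym (descent-≥ (≮⇒≥ x≮y)))

labelN-suc : ∀ {n} (v : Permutation′ n) k →
  labelN v (suc k) ≡ labelN v k + descent (posN v k) (posN v (suc k))
labelN-suc v k = refl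

n*q+r-injective : ∀ n .{{_ : NonZero n}} {q q′ r r′} → r < n → r′ < n →
  n * q + r ≡ n * q′ + r′ → q ≡ q′ × r ≡ r′
n*q+r-injective n {q} {q′} {r} {r′} r<n r′<n eq = q≡q′ , r≡r′
  where
  [n*q+r]%n≡r : ∀ q {r} → r < n → (n * q + r) % n ≡ r
  [n*q+r]%n≡r q {r} r<n = begin
    (n * q + r) % n  ≡⟨ cong (_% n) (trans (+-comm (n * q) r) (cong (r +_) (*-comm n q))) ⟩
    (r + q * n) % n  ≡⟨ [m+kn]%n≡m%n r q n ⟩
    r % n            ≡⟨ m<n⇒m%n≡m r<n ⟩
    r                ∎
  r≡r′ : r ≡ r′
  r≡r′ = trans (sym ([n*q+r]%n≡r q r<n)) (trans (cong (_% n) eq) ([n*q+r]%n≡r q′ r′<n))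
  q≡q′ : q ≡ q′
  q≡q′ = *-cancelˡ-≡ q q′ n
    (+-cancelʳ-≡ r′ (n * q) (n * q′) (subst (λ x → n * q + x ≡ n * q′ + r′) r≡r′ eq))

n*q+suc-toℕ-injective : ∀ {m q q′} {x x′ : Fin (suc m)} →
  suc m * q + suc (toℕ x) ≡ suc m * q′ + suc (toℕ x′) → q ≡ q′ × x ≡ x′
n*q+suc-toℕ-injective {m} {x = x} {x′} eq =
  let q≡q′ , x≡x′ = n*q+r-injective (suc m) (Fin.toℕ<n x) (Fin.toℕ<n x′)
                      (suc-injective (trans (sym (+-suc _ _)) (trans eq (+-suc _ _))))
  in q≡q′ , Fin.toℕ-injective x≡x′

m*n+o+m≡m*[1+n]+o : ∀ m n o → m * n + o + m ≡ m * suc n + o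
m*n+o+m≡m*[1+n]+o m n o = begin
  m * n + o + m    ≡⟨ +-comm (m * n + o) m ⟩
  m + (m * n + o)  ≡⟨ +-assoc m (m * n) o ⟨
  m + m * n + o    ≡⟨ cong (_+ o) (*-suc m n) ⟨
  m * suc n + o    ∎

rotate : ∀ {m} → Fin (suc m) → Fin (suc m)
rotate {m} zero = fromℕ m
rotate (suc j) = inject₁ j

rotate-suc : ∀ {m} (j : Fin (suc m)) → j ≢ zero →
  toℕ (rotate j) < m × toℕ j ≡ suc (toℕ (rotate j))
rotate-suc zero j≢0 = ⊥-elim (j≢0 refl)
rotate-suc (suc i) _ = Fin.inject₁ℕ< i , cong suc (sym (Fin.toℕ-inject₁ i))

last-tabulate : ∀ {A : Set} m (f : Fin (suc m) → A) → last (tabulate f) ≡ f (fromℕ m)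
last-tabulate zero f = refl
last-tabulate (suc m) f = last-tabulate m (f ∘ suc)

init-tabulate : ∀ {A : Set} m (f : Fin (suc m) → A) →
  init (tabulate f) ≡ tabulate (f ∘ inject₁)
init-tabulate zero f = refl
init-tabulate (suc m) f = cong (f zero ∷_) (init-tabulate m (f ∘ suc))

tabulate-injective : ∀ {A : Set} {n} {f g : Fin n → A} →
  tabulate f ≡ tabulate g → ∀ i → f i ≡ g i
tabulate-injective {f = f} {g} eq i =
  trans (sym (lookup∘tabulate f i)) (trans (cong (λ xs → lookup xs i) eq) (lookup∘tabulate g i))

corot-tabulate : ∀ {A : Set} {m} (f : Fin (suc m) → A) →
  corot (tabulate f) ≡ tabulate (f ∘ rotate)
corot-tabulate {m = m} f = cong₂ _∷_ (last-tabulate m f) (init-tabulate m f)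

πW-tabulate : ∀ {m} (f : Fin (suc m) → ℕ) →
  πW (tabulate (ℤ.+_ ∘ f)) ≡ ℤ.+ (f (fromℕ m) + suc m) ∷ tabulate (ℤ.+_ ∘ f ∘ inject₁)
πW-tabulate {m} f =
  cong₂ _∷_ (cong (ℤ._+ ℤ.+ suc m) (last-tabulate m (ℤ.+_ ∘ f))) (init-tabulate m (ℤ.+_ ∘ f))

⟨$⟩ʳ-injective : ∀ {n} (w : Permutation′ n) {x y} → w ⟨$⟩ʳ x ≡ w ⟨$⟩ʳ y → x ≡ y
⟨$⟩ʳ-injective w eq = trans (sym (inverseˡ w)) (trans (cong (w ⟨$⟩ˡ_) eq) (inverseˡ w))

posN-fromℕ< : ∀ {n} (w : Permutation′ n) {k} (k<n : k < n) →
  posN w k ≡ toℕ (w ⟨$⟩ˡ fromℕ< k<n)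
posN-fromℕ< {n} w {k} k<n with k <? n
... | yes _   = refl
... | no k≮n = ⊥-elim (k≮n k<n)

posN-toℕ : ∀ {n} (w : Permutation′ n) x → posN w (toℕ x) ≡ toℕ (w ⟨$⟩ˡ x)
posN-toℕ w x = trans (posN-fromℕ< w (Fin.toℕ<n x)) (cong (toℕ ∘ (w ⟨$⟩ˡ_)) (Fin.fromℕ<-toℕ x _))

φEntry : ∀ {n} → Permutation′ n → Fin n → ℕ
φEntry {n} v j = n * cl v j + suc (toℕ (v ⟨$⟩ʳ j))

window≡corot⇔ : ∀ {m} (v v′ : Permutation′ (suc m)) →
  window v′ ≡ corot (window v) ⇔ (∀ j → v′ ⟨$⟩ʳ j ≡ v ⟨$⟩ʳ rotate j)
window≡corot⇔ v v′ = mk⇔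
  (λ eq → tabulate-injective (trans eq (corot-tabulate (v ⟨$⟩ʳ_))))
  (λ pt → trans (tabulate-cong pt) (sym (corot-tabulate (v ⟨$⟩ʳ_))))

φ≡πWφ⇔ : ∀ {m} (v v′ : Permutation′ (suc m)) →
  φ v′ ≡ πW (φ v) ⇔
  (φEntry v′ zero ≡ φEntry v (fromℕ m) + suc m ×
   (∀ i → φEntry v′ (suc i) ≡ φEntry v (inject₁ i)))
φ≡πWφ⇔ v v′ = mk⇔
  (λ eq → let head≡ , tail≡ = ∷-injective (trans eq (πW-tabulate (φEntry v)))
          in ℤₚ.+-injective head≡ , ℤₚ.+-injective ∘ tabulate-injective tail≡)
  (λ (head≡ , tail≡) →
    trans (cong₂ _∷_ (cong ℤ.+_ head≡) (tabulate-cong (cong ℤ.+_ ∘ tail≡)))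
          (sym (πW-tabulate (φEntry v))))

module Corotation {m} (v v′ : Permutation′ (suc m))
                  (v′≡v∘rotate : ∀ j → v′ ⟨$⟩ʳ j ≡ v ⟨$⟩ʳ rotate j) where

  lastValue : ℕ
  lastValue = toℕ (v ⟨$⟩ʳ fromℕ m)

  v⁻¹≡rotate∘v′⁻¹ : ∀ x → v ⟨$⟩ˡ x ≡ rotate (v′ ⟨$⟩ˡ x)
  v⁻¹≡rotate∘v′⁻¹ x = begin
    v ⟨$⟩ˡ x                          ≡⟨ cong (v ⟨$⟩ˡ_) (inverseʳ v′) ⟨
    v ⟨$⟩ˡ (v′ ⟨$⟩ʳ (v′ ⟨$⟩ˡ x))       ≡⟨ cong (v ⟨$⟩ˡ_) (v′≡v∘rotate _) ⟩
    v ⟨$⟩ˡ (v ⟨$⟩ʳ rotate (v′ ⟨$⟩ˡ x))  ≡⟨ inverseˡ v ⟩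
    rotate (v′ ⟨$⟩ˡ x)                ∎

  posN-lastValue : posN v lastValue ≡ m × posN v′ lastValue ≡ 0
  posN-lastValue =
    trans (posN-toℕ v _) (trans (cong toℕ (inverseˡ v)) (Fin.toℕ-fromℕ m)) ,
    trans (posN-toℕ v′ _)
          (cong toℕ (trans (cong (v′ ⟨$⟩ˡ_) (sym (v′≡v∘rotate zero))) (inverseˡ v′)))

  posN-shift : ∀ {k} → k < suc m → k ≢ lastValue → posN v k < m × posN v′ k ≡ suc (posN v k)
  posN-shift {k} k<n k≢a
    rewrite posN-fromℕ< v k<n | posN-fromℕ< v′ k<n | v⁻¹≡rotate∘v′⁻¹ (fromℕ< k<n) =
    rotate-suc _ λ v′⁻¹k≡0 → k≢a (begin
      k                                   ≡⟨ Fin.toℕ-fromℕ< k<n ⟨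
      toℕ (fromℕ< k<n)                    ≡⟨ cong toℕ (inverseʳ v′) ⟨
      toℕ (v′ ⟨$⟩ʳ (v′ ⟨$⟩ˡ fromℕ< k<n))  ≡⟨ cong (toℕ ∘ (v′ ⟨$⟩ʳ_)) v′⁻¹k≡0 ⟩
      toℕ (v′ ⟨$⟩ʳ zero)                  ≡⟨ cong toℕ (v′≡v∘rotate zero) ⟩
      lastValue                           ∎)

  labelShift : ℕ → ℕ
  labelShift k = if does (k ≟ lastValue) then 1 else 0

  labelShift-lastValue : labelShift lastValue ≡ 1
  labelShift-lastValue rewrite dec-true (lastValue ≟ lastValue) refl = refl

  labelShift-≢ : ∀ {k} → k ≢ lastValue → labelShift k ≡ 0
  labelShift-≢ {k} k≢a rewrite dec-false (k ≟ lastValue) k≢a = refl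

  descent-balance : ∀ k → suc k < suc m →
    labelShift k + descent (posN v′ k) (posN v′ (suc k)) ≡
    descent (posN v k) (posN v (suc k)) + labelShift (suc k)
  descent-balance k 1+k<n with k ≟ lastValue | suc k ≟ lastValue
  ... | yes k≡a | yes 1+k≡a = ⊥-elim (1+n≢n (trans 1+k≡a (sym k≡a)))
  ... | yes k≡a | no 1+k≢a =
    let q<m , q′≡1+q = posN-shift 1+k<n 1+k≢a in begin
    labelShift k + descent (posN v′ k) (posN v′ (suc k))
      ≡⟨ cong₂ _+_ (trans (cong labelShift k≡a) labelShift-lastValue)
                   (cong₂ descent (trans (cong (posN v′) k≡a) (proj₂ posN-lastValue)) q′≡1+q) ⟩
    1 + descent 0 (suc (posN v (suc k)))
      ≡⟨⟩
    1
      ≡⟨ cong₂ _+_ (descent-≥ (<⇒≤ q<m)) (labelShift-≢ 1+k≢a) ⟨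
    descent m (posN v (suc k)) + labelShift (suc k)
      ≡⟨ cong (λ p → descent p (posN v (suc k)) + labelShift (suc k))
              (trans (cong (posN v) k≡a) (proj₁ posN-lastValue)) ⟨
    descent (posN v k) (posN v (suc k)) + labelShift (suc k)
      ∎
  ... | no k≢a | yes 1+k≡a =
    let p<m , p′≡1+p = posN-shift (<-trans (n<1+n k) 1+k<n) k≢a in begin
    labelShift k + descent (posN v′ k) (posN v′ (suc k))
      ≡⟨ cong₂ _+_ (labelShift-≢ k≢a)
                   (cong₂ descent p′≡1+p (trans (cong (posN v′) 1+k≡a) (proj₂ posN-lastValue))) ⟩
    descent (suc (posN v k)) 0
      ≡⟨⟩
    1
      ≡⟨ cong₂ _+_ (descent-< p<m) (trans (cong labelShift 1+k≡a) labelShift-lastValue) ⟨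
    descent (posN v k) m + labelShift (suc k)
      ≡⟨ cong (λ q → descent (posN v k) q + labelShift (suc k))
              (trans (cong (posN v) 1+k≡a) (proj₁ posN-lastValue)) ⟨
    descent (posN v k) (posN v (suc k)) + labelShift (suc k)
      ∎
  ... | no k≢a | no 1+k≢a =
    let _ , p′≡1+p = posN-shift (<-trans (n<1+n k) 1+k<n) k≢a
        _ , q′≡1+q = posN-shift 1+k<n 1+k≢a in begin
    labelShift k + descent (posN v′ k) (posN v′ (suc k))
      ≡⟨ cong₂ _+_ (labelShift-≢ k≢a) (cong₂ descent p′≡1+p q′≡1+q) ⟩
    descent (suc (posN v k)) (suc (posN v (suc k)))
      ≡⟨ descent-suc (posN v k) (posN v (suc k)) ⟩
    descent (posN v k) (posN v (suc k))
      ≡⟨ +-identityʳ _ ⟨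
    descent (posN v k) (posN v (suc k)) + 0
      ≡⟨ cong (descent (posN v k) (posN v (suc k)) +_) (labelShift-≢ 1+k≢a) ⟨
    descent (posN v k) (posN v (suc k)) + labelShift (suc k)
      ∎

  labelN-corotation : lastValue ≢ 0 → ∀ k → k < suc m → labelN v′ k ≡ labelN v k + labelShift k
  labelN-corotation a≢0 zero _ = sym (labelShift-≢ (a≢0 ∘ sym))
  labelN-corotation a≢0 (suc k) 1+k<n = begin
    labelN v′ (suc k)                      ≡⟨ labelN-suc v′ k ⟩
    labelN v′ k + d′                       ≡⟨ cong (_+ d′) (labelN-corotation a≢0 k k<n) ⟩
    labelN v k + labelShift k + d′         ≡⟨ +-assoc (labelN v k) _ _ ⟩
    labelN v k + (labelShift k + d′)       ≡⟨ cong (labelN v k +_) (descent-balance k 1+k<n) ⟩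
    labelN v k + (d + labelShift (suc k))  ≡⟨ +-assoc (labelN v k) _ _ ⟨
    labelN v (suc k) + labelShift (suc k)  ∎
    where
    k<n : k < suc m
    k<n = <-trans (n<1+n k) 1+k<n
    d′ d : ℕ
    d′ = descent (posN v′ k) (posN v′ (suc k))
    d  = descent (posN v k) (posN v (suc k))

  cl-corotation-zero : lastValue ≢ 0 → cl v′ zero ≡ suc (cl v (fromℕ m))
  cl-corotation-zero a≢0 = begin
    labelN v′ (toℕ (v′ ⟨$⟩ʳ zero))             ≡⟨ cong (labelN v′ ∘ toℕ) (v′≡v∘rotate zero) ⟩
    labelN v′ lastValue                        ≡⟨ labelN-corotation a≢0 lastValue (Fin.toℕ<n _) ⟩
    labelN v lastValue + labelShift lastValue  ≡⟨ cong (labelN v lastValue +_) labelShift-lastValue ⟩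
    labelN v lastValue + 1                     ≡⟨ +-comm _ 1 ⟩
    suc (labelN v lastValue)                   ∎

  cl-corotation-suc : lastValue ≢ 0 → ∀ i → cl v′ (suc i) ≡ cl v (inject₁ i)
  cl-corotation-suc a≢0 i = begin
    labelN v′ (toℕ (v′ ⟨$⟩ʳ suc i))  ≡⟨ cong (labelN v′ ∘ toℕ) (v′≡v∘rotate (suc i)) ⟩
    labelN v′ b                      ≡⟨ labelN-corotation a≢0 b (Fin.toℕ<n _) ⟩
    labelN v b + labelShift b        ≡⟨ cong (labelN v b +_) (labelShift-≢ b≢a) ⟩
    labelN v b + 0                   ≡⟨ +-identityʳ _ ⟩
    labelN v b                       ∎
    where
    b : ℕ
    b = toℕ (v ⟨$⟩ʳ inject₁ i)
    b≢a : b ≢ lastValue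
    b≢a = Fin.fromℕ≢inject₁ ∘ sym ∘ ⟨$⟩ʳ-injective v ∘ Fin.toℕ-injective

  φEntry-corotation-zero : lastValue ≢ 0 → φEntry v′ zero ≡ φEntry v (fromℕ m) + suc m
  φEntry-corotation-zero a≢0 = begin
    suc m * cl v′ zero + suc (toℕ (v′ ⟨$⟩ʳ zero))
      ≡⟨ cong₂ (λ c x → suc m * c + suc (toℕ x)) (cl-corotation-zero a≢0) (v′≡v∘rotate zero) ⟩
    suc m * suc (cl v (fromℕ m)) + suc lastValue
      ≡⟨ m*n+o+m≡m*[1+n]+o (suc m) (cl v (fromℕ m)) (suc lastValue) ⟨
    φEntry v (fromℕ m) + suc m
      ∎

  φEntry-corotation-suc : lastValue ≢ 0 → ∀ i → φEntry v′ (suc i) ≡ φEntry v (inject₁ i)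
  φEntry-corotation-suc a≢0 i =
    cong₂ (λ c x → suc m * c + suc (toℕ x)) (cl-corotation-suc a≢0 i) (v′≡v∘rotate (suc i))

corotation⇒φ≡πWφ : ∀ {m} (v v′ : Permutation′ (suc m)) →
  v ⟨$⟩ʳ fromℕ m ≢ zero → window v′ ≡ corot (window v) → φ v′ ≡ πW (φ v)
corotation⇒φ≡πWφ v v′ vₙ≢1 eq =
  from (φ≡πWφ⇔ v v′) (φEntry-corotation-zero a≢0 , φEntry-corotation-suc a≢0)
  where
  open Corotation v v′ (to (window≡corot⇔ v v′) eq)
  a≢0 : lastValue ≢ 0
  a≢0 = vₙ≢1 ∘ Fin.toℕ-injective

φ≡πWφ⇒corotation : ∀ {m} (v v′ : Permutation′ (suc m)) →
  φ v′ ≡ πW (φ v) → v ⟨$⟩ʳ fromℕ m ≢ zero × window v′ ≡ corot (window v)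
φ≡πWφ⇒corotation {m} v v′ eq = vₙ≢1 , from (window≡corot⇔ v v′) v′≡v∘rotate
  where
  entries : φEntry v′ zero ≡ φEntry v (fromℕ m) + suc m ×
            (∀ i → φEntry v′ (suc i) ≡ φEntry v (inject₁ i))
  entries = to (φ≡πWφ⇔ v v′) eq
  firstEntry : cl v′ zero ≡ suc (cl v (fromℕ m)) × v′ ⟨$⟩ʳ zero ≡ v ⟨$⟩ʳ fromℕ m
  firstEntry = n*q+suc-toℕ-injective (trans (proj₁ entries)
    (m*n+o+m≡m*[1+n]+o (suc m) (cl v (fromℕ m)) (suc (toℕ (v ⟨$⟩ʳ fromℕ m)))))
  v′≡v∘rotate : ∀ j → v′ ⟨$⟩ʳ j ≡ v ⟨$⟩ʳ rotate j
  v′≡v∘rotate zero    = proj₂ firstEntry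
  v′≡v∘rotate (suc i) = proj₂ (n*q+suc-toℕ-injective (proj₂ entries i))
  -- the value 1 always carries label 0
  vₙ≢1 : v ⟨$⟩ʳ fromℕ m ≢ zero
  vₙ≢1 vₙ≡1 =
    0≢1+n (trans (sym (cong (labelN v′ ∘ toℕ) (trans (proj₂ firstEntry) vₙ≡1))) (proj₁ firstEntry))

mainTheorem6 : (m : ℕ) → (v v′ : Permutation′ (suc (suc m))) →
    (φ v′ ≡ πW (φ v)) ⇔
    ((v ⟨$⟩ʳ fromℕ (suc m) ≢ zero) × (window v′ ≡ corot (window v)))
mainTheorem6 m v v′ =
  mk⇔ (φ≡πWφ⇒corotation v v′) (λ (vₙ≢1 , eq) → corotation⇒φ≡πWφ v v′ vₙ≢1 eq)
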